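{- Let $\mathcal{A}$ be a minimally self-adjusting BST algorithm that satisfies the access lemma via the SOL potential. Then there is a constant $C$ such that for every after-tree $A$ produced by $\mathcal{A}$ (for an access to $s$), every element $t>s$ of $A$ has right-depth at most $C$ in $A$ and every element $t<s$ of $A$ has left-depth at most $C$ in $A$.
   Context: Keys are $[n]=\{1,\dots,n\}$. For a BST $T$ on $[n]$ and a node $a$, $T(a)$ denotes the set of keys in the subtree of $T$ rooted at $a$. A weight function is $w:[n]\to\mathbb{R}_{>0}$, with $w(S)=\sum_{a\in S}w(a)$ and $W=w([n])$. The SOL potential is $\Phi_T=\sum_{a\in[n]}\log_2 w(T(a))$. A minimally self-adjusting BST algorithm: when key $s$ is accessed in the current tree $T$, let $P$ be the search path (nodes on the root-to-$s$ path, including $s$). The algorithm replaces $P$ by a BST $A$ on the node set $P$ with root $s$ (the after-tree); the subtrees of $T$ hanging off $P$ are reattached to $A$ in the unique way consistent with key order, giving $T'$. Cost: $|P|$. The algorithm satisfies the access lemma via the SOL potential if there is a constant $c'$ such that for all $n$, all BSTs $T$ on $[n]$, all weight functions $w$, all $s$, and all $T'$ the algorithm can produce when accessing $s$ in $T$: $|P|\le\Phi_T-\Phi_{T'}+c'(1+\log_2\frac{W}{w(s)})$. The right-depth (left-depth) of a node is the number of right-going (left-going) edges on the root-to-node path. -}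

module Defs where

open import Data.Nat as ℕ using (ℕ; zero; suc; _<ᵇ_)
open import Data.Bool using (if_then_else_)
open import Data.List using (List; []; _∷_; _++_; length; map; sum; applyUpTo; foldr)
open import Data.List.Relation.Unary.Linked using (Linked)
open import Data.List.Relation.Binary.Permutation.Propositional using (_↭_)
open import Data.Product using (Σ; _×_; _,_; proj₁; ∃₂)
open import Data.Rational as ℚ using (ℚ; 0ℚ; 1ℚ)
open import Relation.Binary.PropositionalEquality using (_≡_)

data Tree : Set where
  leaf : Tree
  node : Tree → ℕ → Tree → Tree

inorder : Tree → List ℕ
inorder leaf = []
inorder (node l k r) = inorder l ++ (k ∷ inorder r)

range : ℕ → List ℕ
range n = applyUpTo suc n

IsBST : ℕ → Tree → Set
IsBST n T = inorder T ≡ range n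

path : ℕ → Tree → List ℕ
path s leaf = []
path s (node l k r) =
  k ∷ (if s <ᵇ k then path s l else (if k <ᵇ s then path s r else []))

-- Subtrees hanging off the search path to s, in left-to-right (key) order.
hang : ℕ → Tree → List Tree
hang s leaf = leaf ∷ []
hang s (node l k r) =
  if s <ᵇ k then hang s l ++ (r ∷ [])
  else (if k <ᵇ s then l ∷ hang s r else l ∷ r ∷ [])

fillAux : Tree → List Tree → Tree × List Tree
fillAux leaf [] = leaf , []
fillAux leaf (g ∷ gs) = g , gs
fillAux (node l k r) gs with fillAux l gs
... | l' , gs₁ with fillAux r gs₁
... | r' , gs₂ = node l' k r' , gs₂

-- T' obtained from T by replacing the search path to s by the after-tree A
-- and reattaching the hanging subtrees in key order.
reattach : Tree → ℕ → Tree → Tree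
reattach T s A = proj₁ (fillAux A (hang s T))

IsAfterTree : Tree → ℕ → Tree → Set
IsAfterTree T s A =
  Linked ℕ._<_ (inorder A) × (inorder A ↭ path s T) ×
  ∃₂ λ l r → A ≡ node l s r

-- A minimally self-adjusting BST algorithm, modelled as a (possibly
-- nondeterministic) relation: Produces n T s A means that, when s is accessed
-- in T (a BST on [n]), the algorithm may use after-tree A.
record MinSelfAdjusting : Set₁ where
  field
    Produces : ℕ → Tree → ℕ → Tree → Set
    valid    : ∀ {n T s A} → IsBST n T → 1 ℕ.≤ s → s ℕ.≤ n →
               Produces n T s A → IsAfterTree T s A

_^ℚ_ : ℚ → ℕ → ℚ
q ^ℚ zero = 1ℚ
q ^ℚ suc k = q ℚ.* (q ^ℚ k)

2ℚ : ℚ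
2ℚ = 1ℚ ℚ.+ 1ℚ

wsum : (ℕ → ℚ) → Tree → ℚ
wsum w leaf = 0ℚ
wsum w (node l k r) = wsum w l ℚ.+ w k ℚ.+ wsum w r

-- 2^{Φ_T} = ∏_{a} w(T(a)).
expPot : (ℕ → ℚ) → Tree → ℚ
expPot w leaf = 1ℚ
expPot w t@(node l k r) = expPot w l ℚ.* expPot w r ℚ.* wsum w t

totalW : (ℕ → ℚ) → ℕ → ℚ
totalW w n = foldr (λ a acc → w a ℚ.+ acc) 0ℚ (range n)

-- The access lemma via the SOL potential, in exponentiated form:
--   |P| ≤ Φ_T − Φ_T' + c'(1 + log₂(W/w(s)))
--   ⇔ 2^|P| · 2^{Φ_T'} · w(s)^{c'} ≤ 2^{Φ_T} · (2W)^{c'}.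
-- (c' may be taken in ℕ w.l.o.g.; weights range over positive rationals.)
SatisfiesAccessLemmaSOL : MinSelfAdjusting → Set
SatisfiesAccessLemmaSOL 𝒜 =
  Σ ℕ λ c′ →
  ∀ (n : ℕ) (T : Tree) (w : ℕ → ℚ) (s : ℕ) (A : Tree) →
  IsBST n T → 1 ℕ.≤ s → s ℕ.≤ n →
  (∀ a → 1 ℕ.≤ a → a ℕ.≤ n → 0ℚ ℚ.< w a) →
  MinSelfAdjusting.Produces 𝒜 n T s A →
  ((2ℚ ^ℚ length (path s T)) ℚ.* expPot w (reattach T s A) ℚ.* (w s ^ℚ c′))
    ℚ.≤ (expPot w T ℚ.* ((2ℚ ℚ.* totalW w n) ^ℚ c′))

rightDepth : ℕ → Tree → ℕ
rightDepth t leaf = 0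
rightDepth t (node l k r) =
  if t <ᵇ k then rightDepth t l else (if k <ᵇ t then suc (rightDepth t r) else 0)

leftDepth : ℕ → Tree → ℕ
leftDepth t leaf = 0
leftDepth t (node l k r) =
  if t <ᵇ k then suc (leftDepth t l) else (if k <ᵇ t then leftDepth t r else 0)

module Submission where

-- Suppose the after-tree A = node l s r is used
-- for an access to s in T, and t > s lies in A (the case t < s is the mirror
-- image).  Let L be the left subtree of the node t in T; every key k of the
-- search path P with s ≤ k < t lies in L, while t does not.  Give the keys of
-- L weight 1 ("light") and every other key a huge weight M ("heavy").  Call a
-- node "exposed" when its subtree contains a heavy key; the SOL potential 2^Φ
-- is then M^(number of exposed nodes) up to a factor n^n.
--   * In T, a node is exposed iff it is heavy, because L is a whole subtree.
--   * In T′ every light node on the search path of t in A becomes exposed, and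
--     these include all right-going nodes of that path.
-- So the number of exposed nodes grows by at least the right-depth of t, while
-- the access lemma, read in ℕ after exponentiation, says it can grow by at
-- most c′ once M is large.  Hence the right-depth of t is at most c′.

open import Defs
open import Data.Nat using (ℕ; zero; suc; _+_; _*_; _^_; _≤_; _<_; z≤n; s≤s; _<ᵇ_; NonZero; >-nonZero⁻¹)
open import Data.Nat.Properties
open import Data.Nat.ListAction using (sum)
open import Data.Nat.ListAction.Properties using (sum-++; sum-↭)
open import Data.Nat.Solver using (module +-*-Solver)
open import Data.Bool using (Bool; true; false; not; if_then_else_; T)
open import Data.List using (List; []; _∷_; _++_; length; map; foldr)
open import Data.List.Properties using (map-++; length-++; length-applyUpTo)
open import Data.List.Relation.Unary.All as All using (All; []; _∷_)
import Data.List.Relation.Unary.All.Properties as All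
open import Data.List.Relation.Unary.AllPairs using (AllPairs; []; _∷_)
open import Data.List.Relation.Unary.AllPairs.Properties using (applyUpTo⁺₁)
open import Data.List.Relation.Unary.Linked.Properties using (Linked⇒AllPairs)
open import Data.List.Relation.Unary.Any using (here; there)
open import Data.List.Membership.Propositional using (_∈_; _∉_)
open import Data.List.Membership.Propositional.Properties using (∈-++⁻; ∈-++⁺ˡ; ∈-++⁺ʳ)
open import Data.List.Membership.DecPropositional _≟_ using (_∈?_)
open import Data.List.Relation.Binary.Permutation.Propositional using (_↭_)
open import Data.List.Relation.Binary.Permutation.Propositional.Properties
  using (map⁺; ∈-resp-↭; ↭-length)
open import Data.Rational as ℚ using (ℚ; 0ℚ; 1ℚ)
import Data.Rational.Properties as ℚ
open import Data.Product using (Σ; _×_; _,_; proj₁; proj₂)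
open import Data.Sum using (inj₁; inj₂)
open import Data.Empty using (⊥-elim)
open import Data.Unit using (⊤; tt)
open import Function using (_∘_)
open import Relation.Nullary using (does)
open import Relation.Binary using (tri<; tri≈; tri>)
open import Relation.Nullary.Decidable using (dec-true; dec-false)
open import Relation.Binary.PropositionalEquality
  using (_≡_; refl; sym; trans; cong; cong₂; subst; subst₂; module ≡-Reasoning)

open +-*-Solver using (solve; _:=_; _:+_; _:*_; con)

<ᵇ-true : ∀ {m n} → m < n → (m <ᵇ n) ≡ true
<ᵇ-true {zero}  {suc n} _         = refl
<ᵇ-true {suc m} {suc n} (s≤s m<n) = <ᵇ-true m<n

<ᵇ-false : ∀ {m n} → n ≤ m → (m <ᵇ n) ≡ false
<ᵇ-false {m}     {zero}  _         = refl
<ᵇ-false {suc m} {suc n} (s≤s n≤m) = <ᵇ-false n≤m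

<ᵇ-sound : ∀ {m n} → (m <ᵇ n) ≡ true → m < n
<ᵇ-sound {m} {n} e = <ᵇ⇒< m n (subst T (sym e) tt)

ind : Bool → ℕ
ind true  = 1
ind false = 0

ind-not : ∀ b → ind (not b) + ind b ≡ 1
ind-not true  = refl
ind-not false = refl

count : (ℕ → Bool) → List ℕ → ℕ
count p xs = sum (map (ind ∘ p) xs)

count-++ : ∀ p xs ys → count p (xs ++ ys) ≡ count p xs + count p ys
count-++ p xs ys = trans (cong sum (map-++ (ind ∘ p) xs ys)) (sum-++ (map (ind ∘ p) xs) _)

count-↭ : ∀ p {xs ys} → xs ↭ ys → count p xs ≡ count p ys
count-↭ p xs↭ys = sum-↭ (map⁺ (ind ∘ p) xs↭ys)

count-mono : ∀ {p q} xs → (∀ {x} → x ∈ xs → p x ≡ true → q x ≡ true) → count p xs ≤ count q xs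
count-mono {p} {q} []       _   = z≤n
count-mono {p} {q} (x ∷ xs) p⇒q = +-mono-≤ (ind-mono (p x) (q x) (p⇒q (here refl)))
                                           (count-mono xs (p⇒q ∘ there))
  where
  ind-mono : ∀ a b → (a ≡ true → b ≡ true) → ind a ≤ ind b
  ind-mono false _ _   = z≤n
  ind-mono true  b a⇒b rewrite a⇒b refl = ≤-refl

count-pos : ∀ p {x} xs → x ∈ xs → p x ≡ true → 1 ≤ count p xs
count-pos p (y ∷ xs) (here refl) px rewrite px = s≤s z≤n
count-pos p (y ∷ xs) (there x∈xs) px = ≤-trans (count-pos p xs x∈xs px) (m≤n+m _ _)

count-all : ∀ p xs → All (λ x → p x ≡ true) xs → count p xs ≡ length xs
count-all p []       []         = refl
count-all p (x ∷ xs) (px ∷ pxs) rewrite px = cong suc (count-all p xs pxs)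

count-none : ∀ p xs → All (λ x → p x ≡ false) xs → count p xs ≡ 0
count-none p []       []         = refl
count-none p (x ∷ xs) (px ∷ pxs) rewrite px = count-none p xs pxs

size : Tree → ℕ
size X = length (inorder X)

size-node : ∀ l k r → size (node l k r) ≡ size l + suc (size r)
size-node l k r = length-++ (inorder l)

Ordered : Tree → Set
Ordered leaf         = ⊤
Ordered (node l k r) = Ordered l × Ordered r × All (_< k) (inorder l) × All (k <_) (inorder r)

allPairs-++⁻ : ∀ {R : ℕ → ℕ → Set} xs {ys} → AllPairs R (xs ++ ys) →
               AllPairs R xs × AllPairs R ys × All (λ x → All (R x) ys) xs
allPairs-++⁻ []       Rys        = [] , Rys , []
allPairs-++⁻ (x ∷ xs) (Rx ∷ Rxys) with allPairs-++⁻ xs Rxys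
... | Rxs , Rys , Rxs-ys = (All.++⁻ˡ xs Rx ∷ Rxs) , Rys , (All.++⁻ʳ xs Rx ∷ Rxs-ys)

increasing⇒ordered : ∀ X → AllPairs _<_ (inorder X) → Ordered X
increasing⇒ordered leaf _ = tt
increasing⇒ordered (node l k r) inc with allPairs-++⁻ (inorder l) inc
... | l-inc , (k< ∷ r-inc) , l<kr =
  increasing⇒ordered l l-inc , increasing⇒ordered r r-inc , All.map (λ { (x<k ∷ _) → x<k }) l<kr , k<

bst⇒ordered : ∀ {n T} → IsBST n T → Ordered T
bst⇒ordered {n} {T} bst =
  increasing⇒ordered T (subst (AllPairs _<_) (sym bst) (applyUpTo⁺₁ suc n (λ i<j _ → s≤s i<j)))

size-bst : ∀ {n} T → IsBST n T → size T ≡ n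
size-bst {n} _ bst = trans (cong length bst) (length-applyUpTo suc n)

data Subtree (L : Tree) : Tree → Set where
  here  : Subtree L L
  left  : ∀ {l k r} → Subtree L l → Subtree L (node l k r)
  right : ∀ {l k r} → Subtree L r → Subtree L (node l k r)

subtree-⊆ : ∀ {L X y} → Subtree L X → y ∈ inorder L → y ∈ inorder X
subtree-⊆ here y∈L = y∈L
subtree-⊆ {X = node l k r} (left  L⊑l) y∈L = ∈-++⁺ˡ (subtree-⊆ L⊑l y∈L)
subtree-⊆ {X = node l k r} (right L⊑r) y∈L = ∈-++⁺ʳ (inorder l) (there (subtree-⊆ L⊑r y∈L))

path-⊆ : ∀ {y} s X → y ∈ path s X → y ∈ inorder X
path-⊆ s (node l k r) y∈P with s <ᵇ k | k <ᵇ s | y∈P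
... | true  | _     | here refl = ∈-++⁺ʳ (inorder l) (here refl)
... | true  | _     | there y∈P′ = ∈-++⁺ˡ (path-⊆ s l y∈P′)
... | false | true  | here refl = ∈-++⁺ʳ (inorder l) (here refl)
... | false | true  | there y∈P′ = ∈-++⁺ʳ (inorder l) (there (path-⊆ s r y∈P′))
... | false | false | here refl = ∈-++⁺ʳ (inorder l) (here refl)

path-< : ∀ {t k} l r → t < k → path t (node l k r) ≡ k ∷ path t l
path-< {t} {k} l r t<k rewrite <ᵇ-true t<k = refl

path-> : ∀ {t k} l r → k < t → path t (node l k r) ≡ k ∷ path t r
path-> {t} {k} l r k<t rewrite <ᵇ-false (<⇒≤ k<t) | <ᵇ-true k<t = refl

rightDepth-count : ∀ t X → rightDepth t X ≡ count (_<ᵇ t) (path t X)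
rightDepth-count t leaf = refl
rightDepth-count t (node l k r) with <-cmp t k
... | tri< t<k _ _ rewrite <ᵇ-true t<k | <ᵇ-false (<⇒≤ t<k) = rightDepth-count t l
... | tri≈ _ refl _ rewrite <ᵇ-false (≤-refl {t}) = refl
... | tri> _ _ k<t rewrite <ᵇ-false (<⇒≤ k<t) | <ᵇ-true k<t = cong suc (rightDepth-count t r)

leftDepth-count : ∀ t X → leftDepth t X ≡ count (t <ᵇ_) (path t X)
leftDepth-count t leaf = refl
leftDepth-count t (node l k r) with <-cmp t k
... | tri< t<k _ _ rewrite <ᵇ-true t<k = cong suc (leftDepth-count t l)
... | tri≈ _ refl _ rewrite <ᵇ-false (≤-refl {t}) = refl
... | tri> _ _ k<t rewrite <ᵇ-false (<⇒≤ k<t) | <ᵇ-true k<t = leftDepth-count t r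

fill : Tree → List Tree → Tree
fill X gs = proj₁ (fillAux X gs)

leftover : Tree → List Tree → List Tree
leftover X gs = proj₂ (fillAux X gs)

fill-⊆ : ∀ {y} X gs → y ∈ inorder X → y ∈ inorder (fill X gs)
fill-⊆ (node l k r) gs y∈X with ∈-++⁻ (inorder l) y∈X
... | inj₁ y∈l         = ∈-++⁺ˡ (fill-⊆ l gs y∈l)
... | inj₂ (here refl) = ∈-++⁺ʳ (inorder (fill l gs)) (here refl)
... | inj₂ (there y∈r) = ∈-++⁺ʳ (inorder (fill l gs)) (there (fill-⊆ r (leftover l gs) y∈r))

countTrees : (ℕ → Bool) → List Tree → ℕ
countTrees p gs = sum (map (count p ∘ inorder) gs)

countTrees-++ : ∀ p gs hs → countTrees p (gs ++ hs) ≡ countTrees p gs + countTrees p hs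
countTrees-++ p gs hs = trans (cong sum (map-++ (count p ∘ inorder) gs hs)) (sum-++ (map (count p ∘ inorder) gs) _)

count-node : ∀ p l k r → count p (inorder (node l k r)) ≡ count p (inorder l) + (ind (p k) + count p (inorder r))
count-node p l k r = count-++ p (inorder l) (k ∷ inorder r)

fill-count : ∀ p X gs → count p (inorder (fill X gs)) + countTrees p (leftover X gs) ≡ count p (inorder X) + countTrees p gs
fill-count p leaf []       = refl
fill-count p leaf (g ∷ gs) = refl
fill-count p (node l k r) gs = begin
  count p (inorder (node l′ k r′)) + R₂   ≡⟨ cong (_+ R₂) (count-node p l′ k r′) ⟩
  cl′ + (b + cr′) + R₂                    ≡⟨ solve 4 (λ a b c d → a :+ (b :+ c) :+ d := a :+ b :+ (c :+ d)) refl cl′ b cr′ R₂ ⟩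
  cl′ + b + (cr′ + R₂)                    ≡⟨ cong (cl′ + b +_) (fill-count p r gs₁) ⟩
  cl′ + b + (count p (inorder r) + R₁)    ≡⟨ solve 4 (λ a b c d → a :+ b :+ (c :+ d) := b :+ c :+ (a :+ d)) refl cl′ b (count p (inorder r)) R₁ ⟩
  b + count p (inorder r) + (cl′ + R₁)    ≡⟨ cong (b + count p (inorder r) +_) (fill-count p l gs) ⟩
  b + count p (inorder r) + (count p (inorder l) + countTrees p gs)
    ≡⟨ solve 4 (λ a b c d → b :+ c :+ (a :+ d) := a :+ (b :+ c) :+ d) refl (count p (inorder l)) b (count p (inorder r)) (countTrees p gs) ⟩
  count p (inorder l) + (b + count p (inorder r)) + countTrees p gs ≡⟨ cong (_+ countTrees p gs) (count-node p l k r) ⟨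
  count p (inorder (node l k r)) + countTrees p gs ∎
  where
  open ≡-Reasoning
  l′  = fill l gs
  gs₁ = leftover l gs
  r′  = fill r gs₁
  b   = ind (p k)
  cl′ = count p (inorder l′)
  cr′ = count p (inorder r′)
  R₁  = countTrees p gs₁
  R₂  = countTrees p (leftover r gs₁)

-- A tree with m keys has m + 1 leaves, so it consumes m + 1 trees of the list.
fill-leftover : ∀ X gs m → length gs ≡ size X + suc m → length (leftover X gs) ≡ m
fill-leftover leaf (g ∷ gs) m len = suc-injective len
fill-leftover (node l k r) gs m len =
  fill-leftover r (leftover l gs) m (fill-leftover l gs (size r + suc m) (begin
    length gs                          ≡⟨ len ⟩
    size (node l k r) + suc m          ≡⟨ cong (_+ suc m) (size-node l k r) ⟩
    size l + suc (size r) + suc m      ≡⟨ +-assoc (size l) (suc (size r)) (suc m) ⟩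
    size l + suc (size r + suc m) ∎))
  where open ≡-Reasoning

path-hang-count : ∀ p s X → count p (inorder X) ≡ count p (path s X) + countTrees p (hang s X)
path-hang-count p s leaf = refl
path-hang-count p s (node l k r) with s <ᵇ k | k <ᵇ s
... | true | _ = begin
  count p (inorder (node l k r))       ≡⟨ count-node p l k r ⟩
  cl + (b + cr)                         ≡⟨ cong (_+ (b + cr)) (path-hang-count p s l) ⟩
  cP + cH + (b + cr)                    ≡⟨ solve 4 (λ P H b r → P :+ H :+ (b :+ r) := b :+ P :+ (H :+ (r :+ con 0))) refl cP cH b cr ⟩
  b + cP + (cH + (cr + 0))              ≡⟨ cong (b + cP +_) (countTrees-++ p (hang s l) (r ∷ [])) ⟨
  b + cP + countTrees p (hang s l ++ r ∷ []) ∎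
  where
  open ≡-Reasoning
  b = ind (p k); cl = count p (inorder l); cr = count p (inorder r)
  cP = count p (path s l); cH = countTrees p (hang s l)
... | false | true = begin
  count p (inorder (node l k r))       ≡⟨ count-node p l k r ⟩
  cl + (b + cr)                         ≡⟨ cong (λ x → cl + (b + x)) (path-hang-count p s r) ⟩
  cl + (b + (cP + cH))                  ≡⟨ solve 4 (λ l b P H → l :+ (b :+ (P :+ H)) := b :+ P :+ (l :+ H)) refl cl b cP cH ⟩
  b + cP + (cl + cH) ∎
  where
  open ≡-Reasoning
  b = ind (p k); cl = count p (inorder l); cr = count p (inorder r)
  cP = count p (path s r); cH = countTrees p (hang s r)
... | false | false = trans (count-node p l k r)
  (solve 3 (λ l b r → l :+ (b :+ r) := b :+ con 0 :+ (l :+ (r :+ con 0))) refl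
    (count p (inorder l)) (ind (p k)) (count p (inorder r)))

hang-length : ∀ s X → length (hang s X) ≡ suc (length (path s X))
hang-length s leaf = refl
hang-length s (node l k r) with s <ᵇ k | k <ᵇ s
... | true  | _     = trans (length-++ (hang s l)) (trans (cong (_+ 1) (hang-length s l)) (+-comm _ 1))
... | false | true  = cong suc (hang-length s r)
... | false | false = refl

reattach-count : ∀ p T s A → inorder A ↭ path s T →
                 count p (inorder (reattach T s A)) ≡ count p (inorder T)
reattach-count p T s A A↭P = begin
  count p (inorder (reattach T s A))                              ≡⟨ +-identityʳ _ ⟨
  count p (inorder (fill A gs)) + 0                               ≡⟨ cong (count p (inorder (fill A gs)) +_) (nothing-left (leftover A gs) used-up) ⟨
  count p (inorder (fill A gs)) + countTrees p (leftover A gs)    ≡⟨ fill-count p A gs ⟩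
  count p (inorder A) + countTrees p gs                           ≡⟨ cong (_+ countTrees p gs) (count-↭ p A↭P) ⟩
  count p (path s T) + countTrees p gs                            ≡⟨ path-hang-count p s T ⟨
  count p (inorder T) ∎
  where
  open ≡-Reasoning
  gs = hang s T
  used-up : length (leftover A gs) ≡ 0
  used-up = fill-leftover A gs 0 (begin
    length gs                 ≡⟨ hang-length s T ⟩
    suc (length (path s T))   ≡⟨ cong suc (↭-length A↭P) ⟨
    suc (size A)              ≡⟨ +-comm 1 (size A) ⟩
    size A + 1 ∎)
  nothing-left : ∀ hs → length hs ≡ 0 → countTrees p hs ≡ 0
  nothing-left [] _ = refl

sign : ℕ → ℕ
sign zero    = 0
sign (suc _) = 1

sign≤1 : ∀ m → sign m ≤ 1
sign≤1 zero    = z≤n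
sign≤1 (suc _) = ≤-refl

sign-pos : ∀ {m} → 1 ≤ m → sign m ≡ 1
sign-pos {suc _} _ = refl

-- With light weight 1 and
-- heavy weight M, the potential is M^(number of exposed nodes) up to a factor
-- n^n (see `Weights`).

module Exposure (light : ℕ → Bool) where

  heavy : ℕ → Bool
  heavy = not ∘ light

  heavyCount : Tree → ℕ
  heavyCount X = count heavy (inorder X)

  touches : Tree → ℕ
  touches X = sign (heavyCount X)

  exposed : Tree → ℕ
  exposed leaf         = 0
  exposed (node l k r) = exposed l + exposed r + touches (node l k r)

  touches-∈ : ∀ {t} X → t ∈ inorder X → light t ≡ false → touches X ≡ 1
  touches-∈ X t∈X heavy-t = sign-pos (count-pos heavy (inorder X) t∈X (cong not heavy-t))

  own-touch : ∀ l k r → ind (heavy k) ≤ touches (node l k r)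
  own-touch l k r with light k in light-k
  ... | true  = z≤n
  ... | false = ≤-reflexive (sym (touches-∈ (node l k r) (∈-++⁺ʳ (inorder l) (here refl)) light-k))

  heavyCount≤exposed : ∀ X → heavyCount X ≤ exposed X
  heavyCount≤exposed leaf = z≤n
  heavyCount≤exposed (node l k r) = begin
    heavyCount (node l k r)                       ≡⟨ count-node heavy l k r ⟩
    heavyCount l + (ind (heavy k) + heavyCount r) ≡⟨ solve 3 (λ a b c → a :+ (b :+ c) := a :+ c :+ b) refl (heavyCount l) (ind (heavy k)) (heavyCount r) ⟩
    heavyCount l + heavyCount r + ind (heavy k)   ≤⟨ +-mono-≤ (+-mono-≤ (heavyCount≤exposed l) (heavyCount≤exposed r)) (own-touch l k r) ⟩
    exposed (node l k r) ∎
    where open ≤-Reasoning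

  exposed≤size : ∀ X → exposed X ≤ size X
  exposed≤size leaf = z≤n
  exposed≤size (node l k r) = begin
    exposed l + exposed r + touches (node l k r) ≤⟨ +-mono-≤ (+-mono-≤ (exposed≤size l) (exposed≤size r)) (sign≤1 _) ⟩
    size l + size r + 1                          ≡⟨ solve 2 (λ a b → a :+ b :+ con 1 := a :+ (con 1 :+ b)) refl (size l) (size r) ⟩
    size l + suc (size r)                        ≡⟨ size-node l k r ⟨
    size (node l k r) ∎
    where open ≤-Reasoning

  exposed-light : ∀ X → All (λ y → light y ≡ true) (inorder X) → exposed X ≡ 0
  exposed-light leaf _ = refl
  exposed-light (node l k r) all-light
    rewrite count-none heavy (inorder (node l k r)) (All.map (cong not) all-light)
          | exposed-light l (All.++⁻ˡ (inorder l) all-light)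
          | exposed-light r (All.tail (All.++⁻ʳ (inorder l) all-light)) = refl

  -- One step down a search path through an exposed node k: k adds one exposed
  -- node but a heavy key only when k is heavy, so a light k raises the excess
  -- of exposed nodes over heavy keys by one.
  exposed-step : ∀ l k r x → touches (node l k r) ≡ 1 →
                 heavyCount l + heavyCount r + x ≤ exposed l + exposed r →
                 heavyCount (node l k r) + (ind (light k) + x) ≤ exposed (node l k r)
  exposed-step l k r x k-touches below = begin
    heavyCount (node l k r) + (ind (light k) + x)                   ≡⟨ cong (_+ _) (count-node heavy l k r) ⟩
    heavyCount l + (ind (heavy k) + heavyCount r) + (ind (light k) + x)
      ≡⟨ solve 5 (λ a h c g d → a :+ (h :+ c) :+ (g :+ d) := a :+ c :+ d :+ (h :+ g)) refl
           (heavyCount l) (ind (heavy k)) (heavyCount r) (ind (light k)) x ⟩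
    heavyCount l + heavyCount r + x + (ind (heavy k) + ind (light k)) ≡⟨ cong (heavyCount l + heavyCount r + x +_) (ind-not (light k)) ⟩
    heavyCount l + heavyCount r + x + 1                             ≤⟨ +-monoˡ-≤ 1 below ⟩
    exposed l + exposed r + 1                                       ≡⟨ cong (exposed l + exposed r +_) k-touches ⟨
    exposed (node l k r) ∎
    where open ≤-Reasoning

  -- Key lemma for the after-tree: once the hanging subtrees are filled in,
  -- every node on the search path of a heavy key t is exposed, so each light
  -- one adds to the excess of exposed nodes over heavy keys.
  exposure-on-path : ∀ {t} → light t ≡ false → ∀ A gs → Ordered A → t ∈ inorder A →
                     heavyCount (fill A gs) + count light (path t A) ≤ exposed (fill A gs)
  exposure-on-path {t} heavy-t (node l k r) gs (ord-l , ord-r , l<k , k<r) t∈A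
    with ∈-++⁻ (inorder l) t∈A
  ... | inj₁ t∈l rewrite <ᵇ-true (All.lookup l<k t∈l) =
    exposed-step l′ k r′ (count light (path t l)) t-touches (begin
      heavyCount l′ + heavyCount r′ + count light (path t l)
        ≡⟨ solve 3 (λ a c d → a :+ c :+ d := a :+ d :+ c) refl (heavyCount l′) (heavyCount r′) (count light (path t l)) ⟩
      heavyCount l′ + count light (path t l) + heavyCount r′
        ≤⟨ +-mono-≤ (exposure-on-path heavy-t l gs ord-l t∈l) (heavyCount≤exposed r′) ⟩
      exposed l′ + exposed r′ ∎)
    where
    open ≤-Reasoning
    l′ = fill l gs
    r′ = fill r (leftover l gs)
    t-touches : touches (node l′ k r′) ≡ 1
    t-touches = touches-∈ (node l′ k r′) (fill-⊆ (node l k r) gs t∈A) heavy-t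
  ... | inj₂ (here refl) rewrite <ᵇ-false (≤-refl {t}) | heavy-t | +-identityʳ (heavyCount (fill (node l t r) gs)) =
    heavyCount≤exposed (fill (node l t r) gs)
  ... | inj₂ (there t∈r) rewrite <ᵇ-false (<⇒≤ (All.lookup k<r t∈r)) | <ᵇ-true (All.lookup k<r t∈r) =
    exposed-step l′ k r′ (count light (path t r)) t-touches (begin
      heavyCount l′ + heavyCount r′ + count light (path t r)
        ≡⟨ +-assoc (heavyCount l′) (heavyCount r′) (count light (path t r)) ⟩
      heavyCount l′ + (heavyCount r′ + count light (path t r))
        ≤⟨ +-mono-≤ (heavyCount≤exposed l′) (exposure-on-path heavy-t r (leftover l gs) ord-r t∈r) ⟩
      exposed l′ + exposed r′ ∎)
    where
    open ≤-Reasoning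
    l′ = fill l gs
    r′ = fill r (leftover l gs)
    t-touches : touches (node l′ k r′) ≡ 1
    t-touches = touches-∈ (node l′ k r′) (fill-⊆ (node l k r) gs t∈A) heavy-t

inL : Tree → ℕ → Bool
inL L y = does (y ∈? inorder L)

module LightSubtree (L : Tree) where
  open Exposure (inL L) public

  inside : ∀ {y} → y ∈ inorder L → inL L y ≡ true
  inside y∈L = dec-true (_ ∈? inorder L) y∈L

  outside : ∀ {y} → y ∉ inorder L → inL L y ≡ false
  outside y∉L = dec-false (_ ∈? inorder L) y∉L

  -- When L is a subtree of an ordered tree X, every exposed node of X is
  -- heavy: a node inside L sees only light keys, and a node outside L is
  -- itself heavy (with `heavyCount≤exposed`, the two numbers agree).
  exposed-subtree : ∀ X → Ordered X → Subtree L X → exposed X ≤ heavyCount X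
  exposed-subtree X _ here = ≤-trans (≤-reflexive (exposed-light L (All.tabulate inside))) z≤n
  exposed-subtree (node l k r) (ord-l , _ , l<k , k<r) (left L⊑l) = begin
    exposed l + exposed r + touches (node l k r)
      ≤⟨ +-mono-≤ (+-mono-≤ (exposed-subtree l ord-l L⊑l) (exposed≤size r)) (sign≤1 _) ⟩
    heavyCount l + size r + 1                     ≡⟨ solve 2 (λ a b → a :+ b :+ con 1 := a :+ (con 1 :+ b)) refl (heavyCount l) (size r) ⟩
    heavyCount l + (1 + size r)                   ≡⟨ cong₂ (λ h c → heavyCount l + (ind h + c)) (cong not k-outside) r-heavy ⟨
    heavyCount l + (ind (heavy k) + heavyCount r) ≡⟨ count-node heavy l k r ⟨
    heavyCount (node l k r) ∎
    where
    open ≤-Reasoning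
    k-outside : inL L k ≡ false
    k-outside = outside (λ k∈L → <-irrefl refl (All.lookup l<k (subtree-⊆ L⊑l k∈L)))
    r-heavy : heavyCount r ≡ size r
    r-heavy = count-all heavy (inorder r)
      (All.map (λ k<y → cong not (outside (λ y∈L → <-asym k<y (All.lookup l<k (subtree-⊆ L⊑l y∈L))))) k<r)
  exposed-subtree (node l k r) (_ , ord-r , l<k , k<r) (right L⊑r) = begin
    exposed l + exposed r + touches (node l k r)
      ≤⟨ +-mono-≤ (+-mono-≤ (exposed≤size l) (exposed-subtree r ord-r L⊑r)) (sign≤1 _) ⟩
    size l + heavyCount r + 1                     ≡⟨ solve 2 (λ a b → a :+ b :+ con 1 := a :+ (con 1 :+ b)) refl (size l) (heavyCount r) ⟩
    size l + (1 + heavyCount r)                   ≡⟨ cong₂ (λ c h → c + (ind h + heavyCount r)) l-heavy (cong not k-outside) ⟨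
    heavyCount l + (ind (heavy k) + heavyCount r) ≡⟨ count-node heavy l k r ⟨
    heavyCount (node l k r) ∎
    where
    open ≤-Reasoning
    k-outside : inL L k ≡ false
    k-outside = outside (λ k∈L → <-irrefl refl (All.lookup k<r (subtree-⊆ L⊑r k∈L)))
    l-heavy : heavyCount l ≡ size l
    l-heavy = count-all heavy (inorder l)
      (All.map (λ y<k → cong not (outside (λ y∈L → <-asym y<k (All.lookup k<r (subtree-⊆ L⊑r y∈L))))) l<k)

-- ℕ embeds into ℚ as an ordered semiring; this moves the access lemma,
-- stated in ℚ, to ℕ.

fromℕ : ℕ → ℚ
fromℕ zero    = 0ℚ
fromℕ (suc n) = 1ℚ ℚ.+ fromℕ n

fromℕ-+ : ∀ a b → fromℕ (a + b) ≡ fromℕ a ℚ.+ fromℕ b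
fromℕ-+ zero    b = sym (ℚ.+-identityˡ (fromℕ b))
fromℕ-+ (suc a) b = trans (cong (1ℚ ℚ.+_) (fromℕ-+ a b)) (sym (ℚ.+-assoc 1ℚ (fromℕ a) (fromℕ b)))

fromℕ-* : ∀ a b → fromℕ (a * b) ≡ fromℕ a ℚ.* fromℕ b
fromℕ-* zero    b = sym (ℚ.*-zeroˡ (fromℕ b))
fromℕ-* (suc a) b = begin
  fromℕ (b + a * b)                        ≡⟨ fromℕ-+ b (a * b) ⟩
  fromℕ b ℚ.+ fromℕ (a * b)                ≡⟨ cong₂ ℚ._+_ (sym (ℚ.*-identityˡ (fromℕ b))) (fromℕ-* a b) ⟩
  1ℚ ℚ.* fromℕ b ℚ.+ fromℕ a ℚ.* fromℕ b   ≡⟨ ℚ.*-distribʳ-+ (fromℕ b) 1ℚ (fromℕ a) ⟨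
  (1ℚ ℚ.+ fromℕ a) ℚ.* fromℕ b ∎
  where open ≡-Reasoning

fromℕ-^ : ∀ a k → fromℕ a ^ℚ k ≡ fromℕ (a ^ k)
fromℕ-^ a zero    = ℚ.+-identityʳ 1ℚ
fromℕ-^ a (suc k) = trans (cong (fromℕ a ℚ.*_) (fromℕ-^ a k)) (sym (fromℕ-* a (a ^ k)))

fromℕ-2 : 2ℚ ≡ fromℕ 2
fromℕ-2 = cong (1ℚ ℚ.+_) (sym (ℚ.+-identityʳ 1ℚ))

fromℕ-<-suc : ∀ m → fromℕ m ℚ.< fromℕ (suc m)
fromℕ-<-suc m = subst (ℚ._< 1ℚ ℚ.+ fromℕ m) (ℚ.+-identityˡ (fromℕ m)) (ℚ.+-monoˡ-< (fromℕ m) (ℚ.positive⁻¹ 1ℚ))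

fromℕ-< : ∀ {a b} → a < b → fromℕ a ℚ.< fromℕ b
fromℕ-< {a} {suc b} (s≤s a≤b) with m≤n⇒m<n∨m≡n a≤b
... | inj₁ a<b  = ℚ.<-trans (fromℕ-< a<b) (fromℕ-<-suc b)
... | inj₂ refl = fromℕ-<-suc a

fromℕ-≤-reflect : ∀ {a b} → fromℕ a ℚ.≤ fromℕ b → a ≤ b
fromℕ-≤-reflect {a} {b} a≤b = ≮⇒≥ (λ b<a → ℚ.<-irrefl refl (ℚ.≤-<-trans a≤b (fromℕ-< b<a)))

-- Each subtree weighs between M^[it touches a heavy key] and n times that,
-- so the potential (the product of subtree weights) is M^exposed up to a
-- factor n^n.

module Weights (light : ℕ → Bool) (M : ℕ) .{{_ : NonZero M}} where
  open Exposure light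

  weight : ℕ → ℕ
  weight y = if light y then 1 else M

  weightSum : List ℕ → ℕ
  weightSum xs = sum (map weight xs)

  potential : Tree → ℕ
  potential leaf         = 1
  potential (node l k r) = potential l * potential r * weightSum (inorder (node l k r))

  1≤M : 1 ≤ M
  1≤M = >-nonZero⁻¹ M

  1≤weight : ∀ y → 1 ≤ weight y
  1≤weight y with light y
  ... | true  = ≤-refl
  ... | false = 1≤M

  weightSum≤ : ∀ xs → weightSum xs ≤ length xs * M
  weightSum≤ []       = z≤n
  weightSum≤ (x ∷ xs) = +-mono-≤ (weight≤M x) (weightSum≤ xs)
    where
    weight≤M : ∀ y → weight y ≤ M
    weight≤M y with light y
    ... | true  = 1≤M
    ... | false = ≤-refl

  weightSum-light : ∀ xs → count heavy xs ≡ 0 → weightSum xs ≡ length xs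
  weightSum-light []       _ = refl
  weightSum-light (x ∷ xs) none with light x
  ... | true = cong suc (weightSum-light xs none)

  weightSum-heavy : ∀ xs → 1 ≤ count heavy xs → M ≤ weightSum xs
  weightSum-heavy (x ∷ xs) some with light x
  ... | true  = ≤-trans (weightSum-heavy xs some) (m≤n+m _ 1)
  ... | false = m≤m+n M _

  weightSum-lower : ∀ xs → 1 ≤ length xs → M ^ (sign (count heavy xs)) ≤ weightSum xs
  weightSum-lower xs nonempty with count heavy xs in c
  ... | zero  = subst (1 ≤_) (sym (weightSum-light xs c)) nonempty
  ... | suc _ = subst (_≤ weightSum xs) (sym (*-identityʳ M)) (weightSum-heavy xs (subst (1 ≤_) (sym c) (s≤s z≤n)))

  weightSum-upper : ∀ xs → weightSum xs ≤ length xs * M ^ (sign (count heavy xs))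
  weightSum-upper xs with count heavy xs in c
  ... | zero  = ≤-reflexive (trans (weightSum-light xs c) (sym (*-identityʳ _)))
  ... | suc _ = subst (λ m → weightSum xs ≤ length xs * m) (sym (*-identityʳ M)) (weightSum≤ xs)

  potential-lower : ∀ X → M ^ exposed X ≤ potential X
  potential-lower leaf = ≤-refl
  potential-lower (node l k r) = begin
    M ^ (exposed l + exposed r + touches X)           ≡⟨ ^-distribˡ-+-* M (exposed l + exposed r) (touches X) ⟩
    M ^ (exposed l + exposed r) * M ^ touches X       ≡⟨ cong (_* M ^ touches X) (^-distribˡ-+-* M (exposed l) (exposed r)) ⟩
    M ^ exposed l * M ^ exposed r * M ^ touches X
      ≤⟨ *-mono-≤ (*-mono-≤ (potential-lower l) (potential-lower r)) (weightSum-lower (inorder X) nonempty) ⟩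
    potential X ∎
    where
    open ≤-Reasoning
    X = node l k r
    nonempty : 1 ≤ size X
    nonempty = subst (1 ≤_) (sym (size-node l k r)) (≤-trans (s≤s z≤n) (m≤n+m _ (size l)))

  potential-upper : ∀ S X → size X ≤ S → potential X ≤ S ^ size X * M ^ exposed X
  potential-upper S leaf _ = ≤-refl
  potential-upper S (node l k r) X≤S = begin
    potential l * potential r * weightSum (inorder X)
      ≤⟨ *-mono-≤ (*-mono-≤ (potential-upper S l l≤S) (potential-upper S r r≤S))
                  (≤-trans (weightSum-upper (inorder X)) (*-monoˡ-≤ (M ^ touches X) X≤S)) ⟩
    S ^ size l * M ^ exposed l * (S ^ size r * M ^ exposed r) * (S * M ^ touches X)
      ≡⟨ solve 6 (λ a b c d e g → a :* b :* (c :* d) :* (e :* g) := a :* (e :* c) :* (b :* d :* g)) refl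
           (S ^ size l) (M ^ exposed l) (S ^ size r) (M ^ exposed r) S (M ^ touches X) ⟩
    S ^ size l * S ^ suc (size r) * (M ^ exposed l * M ^ exposed r * M ^ touches X)
      ≡⟨ cong₂ _*_ (sym (^-distribˡ-+-* S (size l) (suc (size r))))
                   (trans (cong (_* M ^ touches X) (sym (^-distribˡ-+-* M (exposed l) (exposed r))))
                          (sym (^-distribˡ-+-* M (exposed l + exposed r) (touches X)))) ⟩
    S ^ (size l + suc (size r)) * M ^ exposed X        ≡⟨ cong (λ m → S ^ m * M ^ exposed X) (size-node l k r) ⟨
    S ^ size X * M ^ exposed X ∎
    where
    open ≤-Reasoning
    X = node l k r
    l≤S : size l ≤ S
    l≤S = ≤-trans (m≤m+n (size l) (suc (size r))) (subst (_≤ S) (size-node l k r) X≤S)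
    r≤S : size r ≤ S
    r≤S = ≤-trans (≤-trans (n≤1+n (size r)) (m≤n+m (suc (size r)) (size l))) (subst (_≤ S) (size-node l k r) X≤S)

  w : ℕ → ℚ
  w = fromℕ ∘ weight

  w-positive : ∀ y → 0ℚ ℚ.< w y
  w-positive y = fromℕ-< (1≤weight y)

  weightSum-node : ∀ l k r → weightSum (inorder (node l k r)) ≡ weightSum (inorder l) + (weight k + weightSum (inorder r))
  weightSum-node l k r = trans (cong sum (map-++ weight (inorder l) _)) (sum-++ (map weight (inorder l)) _)

  wsum-fromℕ : ∀ X → wsum w X ≡ fromℕ (weightSum (inorder X))
  wsum-fromℕ leaf = refl
  wsum-fromℕ (node l k r) = begin
    wsum w l ℚ.+ w k ℚ.+ wsum w r                     ≡⟨ cong₂ (λ a c → a ℚ.+ w k ℚ.+ c) (wsum-fromℕ l) (wsum-fromℕ r) ⟩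
    fromℕ a ℚ.+ fromℕ (weight k) ℚ.+ fromℕ c          ≡⟨ ℚ.+-assoc (fromℕ a) (fromℕ (weight k)) (fromℕ c) ⟩
    fromℕ a ℚ.+ (fromℕ (weight k) ℚ.+ fromℕ c)        ≡⟨ cong (fromℕ a ℚ.+_) (fromℕ-+ (weight k) c) ⟨
    fromℕ a ℚ.+ fromℕ (weight k + c)                  ≡⟨ fromℕ-+ a (weight k + c) ⟨
    fromℕ (a + (weight k + c))                        ≡⟨ cong fromℕ (weightSum-node l k r) ⟨
    fromℕ (weightSum (inorder (node l k r))) ∎
    where
    open ≡-Reasoning
    a = weightSum (inorder l)
    c = weightSum (inorder r)

  expPot-fromℕ : ∀ X → expPot w X ≡ fromℕ (potential X)
  expPot-fromℕ leaf = ℚ.+-identityʳ 1ℚ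
  expPot-fromℕ X@(node l k r) = begin
    expPot w l ℚ.* expPot w r ℚ.* wsum w X
      ≡⟨ cong₂ ℚ._*_ (cong₂ ℚ._*_ (expPot-fromℕ l) (expPot-fromℕ r)) (wsum-fromℕ X) ⟩
    fromℕ (potential l) ℚ.* fromℕ (potential r) ℚ.* fromℕ (weightSum (inorder X))
      ≡⟨ cong (ℚ._* fromℕ (weightSum (inorder X))) (fromℕ-* (potential l) (potential r)) ⟨
    fromℕ (potential l * potential r) ℚ.* fromℕ (weightSum (inorder X))
      ≡⟨ fromℕ-* (potential l * potential r) (weightSum (inorder X)) ⟨
    fromℕ (potential X) ∎
    where open ≡-Reasoning

  totalW-fromℕ : ∀ xs → foldr (λ a acc → w a ℚ.+ acc) 0ℚ xs ≡ fromℕ (weightSum xs)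
  totalW-fromℕ []       = refl
  totalW-fromℕ (x ∷ xs) = trans (cong (w x ℚ.+_) (totalW-fromℕ xs)) (sym (fromℕ-+ (weight x) (weightSum xs)))

split-right : ∀ {s t} X → Ordered X → s < t → t ∈ path s X →
  Σ Tree λ L → Subtree L X × t ∉ inorder L × (∀ {k} → k ∈ path s X → s ≤ k → k < t → k ∈ inorder L)
split-right {s} {t} (node l k r) (ord-l , ord-r , l<k , k<r) s<t t∈P with <-cmp s k
... | tri< s<k _ _ rewrite <ᵇ-true s<k with t∈P
...   | here refl = l , left here , (λ t∈l → <-irrefl refl (All.lookup l<k t∈l)) , below-t
  where
  below-t : ∀ {k′} → k′ ∈ t ∷ path s l → s ≤ k′ → k′ < t → k′ ∈ inorder l
  below-t (here refl) _ t<t = ⊥-elim (<-irrefl refl t<t)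
  below-t (there k′∈P) _ _ = path-⊆ s l k′∈P
...   | there t∈P′ with split-right l ord-l s<t t∈P′
...     | L , L⊑l , t∉L , in-L = L , left L⊑l , t∉L , in-L′
  where
  in-L′ : ∀ {k′} → k′ ∈ k ∷ path s l → s ≤ k′ → k′ < t → k′ ∈ inorder L
  in-L′ (here refl) _ k<t = ⊥-elim (<-asym k<t (All.lookup l<k (path-⊆ s l t∈P′)))
  in-L′ (there k′∈P) = in-L k′∈P
split-right {s} {t} (node l k r) _ s<t t∈P | tri≈ _ refl _ rewrite <ᵇ-false (≤-refl {s}) with t∈P
... | here refl = ⊥-elim (<-irrefl refl s<t)
split-right {s} {t} (node l k r) (ord-l , ord-r , l<k , k<r) s<t t∈P | tri> _ _ k<s
  rewrite <ᵇ-false (<⇒≤ k<s) | <ᵇ-true k<s with t∈P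
... | here refl = ⊥-elim (<-asym k<s s<t)
... | there t∈P′ with split-right r ord-r s<t t∈P′
...   | L , L⊑r , t∉L , in-L = L , right L⊑r , t∉L , in-L′
  where
  in-L′ : ∀ {k′} → k′ ∈ k ∷ path s r → s ≤ k′ → k′ < t → k′ ∈ inorder L
  in-L′ (here refl) s≤k _ = ⊥-elim (<-irrefl refl (<-≤-trans k<s s≤k))
  in-L′ (there k′∈P) = in-L k′∈P

split-left : ∀ {s t} X → Ordered X → t < s → t ∈ path s X →
  Σ Tree λ L → Subtree L X × t ∉ inorder L × (∀ {k} → k ∈ path s X → t < k → k ≤ s → k ∈ inorder L)
split-left {s} {t} (node l k r) (ord-l , ord-r , l<k , k<r) t<s t∈P with <-cmp s k
... | tri< s<k _ _ rewrite <ᵇ-true s<k with t∈P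
...   | here refl = ⊥-elim (<-asym t<s s<k)
...   | there t∈P′ with split-left l ord-l t<s t∈P′
...     | L , L⊑l , t∉L , in-L = L , left L⊑l , t∉L , in-L′
  where
  in-L′ : ∀ {k′} → k′ ∈ k ∷ path s l → t < k′ → k′ ≤ s → k′ ∈ inorder L
  in-L′ (here refl) _ k≤s = ⊥-elim (<-irrefl refl (<-≤-trans s<k k≤s))
  in-L′ (there k′∈P) = in-L k′∈P
split-left {s} {t} (node l k r) _ t<s t∈P | tri≈ _ refl _ rewrite <ᵇ-false (≤-refl {s}) with t∈P
... | here refl = ⊥-elim (<-irrefl refl t<s)
split-left {s} {t} (node l k r) (ord-l , ord-r , l<k , k<r) t<s t∈P | tri> _ _ k<s
  rewrite <ᵇ-false (<⇒≤ k<s) | <ᵇ-true k<s with t∈P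
... | here refl = r , right here , (λ t∈r → <-irrefl refl (All.lookup k<r t∈r)) , above-t
  where
  above-t : ∀ {k′} → k′ ∈ t ∷ path s r → t < k′ → k′ ≤ s → k′ ∈ inorder r
  above-t (here refl) t<t _ = ⊥-elim (<-irrefl refl t<t)
  above-t (there k′∈P) _ _ = path-⊆ s r k′∈P
... | there t∈P′ with split-left r ord-r t<s t∈P′
...   | L , L⊑r , t∉L , in-L = L , right L⊑r , t∉L , in-L′
  where
  in-L′ : ∀ {k′} → k′ ∈ k ∷ path s r → t < k′ → k′ ≤ s → k′ ∈ inorder L
  in-L′ (here refl) t<k _ = ⊥-elim (<-asym t<k (All.lookup k<r (path-⊆ s r t∈P′)))
  in-L′ (there k′∈P) = in-L k′∈P

path-above-root : ∀ {s t k} l r → All (s <_) (inorder r) → s < t → k ∈ path t (node l s r) → s ≤ k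
path-above-root {t = t} {k} l r s<r s<t k∈P with subst (k ∈_) (path-> {t} l r s<t) k∈P
... | here refl   = ≤-refl
... | there k∈P′ = <⇒≤ (All.lookup s<r (path-⊆ t r k∈P′))

path-below-root : ∀ {s t k} l r → All (_< s) (inorder l) → t < s → k ∈ path t (node l s r) → k ≤ s
path-below-root {t = t} {k} l r l<s t<s k∈P with subst (k ∈_) (path-< {t} l r t<s) k∈P
... | here refl   = ≤-refl
... | there k∈P′ = <⇒≤ (All.lookup l<s (path-⊆ t l k∈P′))

rightDepth≤light : ∀ light t X → (∀ {k} → k ∈ path t X → k < t → light k ≡ true) →
                   rightDepth t X ≤ count light (path t X)
rightDepth≤light light t X below-light =
  subst (_≤ count light (path t X)) (sym (rightDepth-count t X))
        (count-mono (path t X) (λ k∈P k<ᵇt → below-light k∈P (<ᵇ-sound k<ᵇt)))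

leftDepth≤light : ∀ light t X → (∀ {k} → k ∈ path t X → t < k → light k ≡ true) →
                  leftDepth t X ≤ count light (path t X)
leftDepth≤light light t X above-light =
  subst (_≤ count light (path t X)) (sym (leftDepth-count t X))
        (count-mono (path t X) (λ k∈P t<ᵇk → above-light k∈P (<ᵇ-sound t<ᵇk)))

*-^-distrib : ∀ a b k → (a * b) ^ k ≡ a ^ k * b ^ k
*-^-distrib a b zero    = refl
*-^-distrib a b (suc k) = trans (cong (a * b *_) (*-^-distrib a b k))
  (solve 4 (λ a b x y → a :* b :* (x :* y) := a :* x :* (b :* y)) refl a b (a ^ k) (b ^ k))

after-tree : ∀ {T s A} → IsAfterTree T s A →
  Σ Tree λ l → Σ Tree λ r → A ≡ node l s r × Ordered A × inorder A ↭ path s T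
after-tree {A = A} (increasing , A↭P , l , r , A≡lsr) =
  l , r , A≡lsr , increasing⇒ordered A (Linked⇒AllPairs <-trans increasing) , A↭P

module AccessLemma (𝒜 : MinSelfAdjusting) (sol : SatisfiesAccessLemmaSOL 𝒜) where
  open MinSelfAdjusting 𝒜

  c′ : ℕ
  c′ = proj₁ sol

  module _ (light : ℕ → Bool) where
    open Exposure light

    -- With heavy weight M = 1 + n^n (2n)^c′, the potential is M^exposed up to
    -- a factor n^n, so the access lemma lets exposure grow by at most c′.
    exposure-gain-bounded : ∀ n T s A → IsBST n T → 1 ≤ s → s ≤ n → Produces n T s A →
      ∀ D → exposed T + D ≤ exposed (reattach T s A) → D ≤ c′
    exposure-gain-bounded n T s A bst 1≤s s≤n prod D gain = ≮⇒≥ (λ c′<D → <-irrefl refl (contradiction c′<D))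
      where
      K = n ^ n * (2 * n) ^ c′
      M = suc K
      open Weights light M
      T′ = reattach T s A
      e  = exposed T
      p  = length (path s T)
      W  = weightSum (range n)

      access : 2 ^ p * potential T′ * weight s ^ c′ ≤ potential T * (2 * W) ^ c′
      access = fromℕ-≤-reflect (subst₂ ℚ._≤_ lhs rhs (proj₂ sol n T w s A bst 1≤s s≤n (λ a _ _ → w-positive a) prod))
        where
        open ≡-Reasoning
        lhs : (2ℚ ^ℚ p) ℚ.* expPot w T′ ℚ.* (w s ^ℚ c′) ≡ fromℕ (2 ^ p * potential T′ * weight s ^ c′)
        lhs = begin
          (2ℚ ^ℚ p) ℚ.* expPot w T′ ℚ.* (w s ^ℚ c′)
            ≡⟨ cong₂ ℚ._*_ (cong₂ ℚ._*_ (trans (cong (_^ℚ p) fromℕ-2) (fromℕ-^ 2 p)) (expPot-fromℕ T′)) (fromℕ-^ (weight s) c′) ⟩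
          fromℕ (2 ^ p) ℚ.* fromℕ (potential T′) ℚ.* fromℕ (weight s ^ c′)
            ≡⟨ cong (ℚ._* fromℕ (weight s ^ c′)) (fromℕ-* (2 ^ p) (potential T′)) ⟨
          fromℕ (2 ^ p * potential T′) ℚ.* fromℕ (weight s ^ c′)
            ≡⟨ fromℕ-* (2 ^ p * potential T′) (weight s ^ c′) ⟨
          fromℕ (2 ^ p * potential T′ * weight s ^ c′) ∎
        rhs : expPot w T ℚ.* ((2ℚ ℚ.* totalW w n) ^ℚ c′) ≡ fromℕ (potential T * (2 * W) ^ c′)
        rhs = begin
          expPot w T ℚ.* ((2ℚ ℚ.* totalW w n) ^ℚ c′)
            ≡⟨ cong₂ (λ x y → x ℚ.* ((y ℚ.* totalW w n) ^ℚ c′)) (expPot-fromℕ T) fromℕ-2 ⟩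
          fromℕ (potential T) ℚ.* ((fromℕ 2 ℚ.* totalW w n) ^ℚ c′)
            ≡⟨ cong (λ x → fromℕ (potential T) ℚ.* ((fromℕ 2 ℚ.* x) ^ℚ c′)) (totalW-fromℕ (range n)) ⟩
          fromℕ (potential T) ℚ.* ((fromℕ 2 ℚ.* fromℕ W) ^ℚ c′)
            ≡⟨ cong (λ x → fromℕ (potential T) ℚ.* (x ^ℚ c′)) (fromℕ-* 2 W) ⟨
          fromℕ (potential T) ℚ.* (fromℕ (2 * W) ^ℚ c′)
            ≡⟨ cong (fromℕ (potential T) ℚ.*_) (fromℕ-^ (2 * W) c′) ⟩
          fromℕ (potential T) ℚ.* fromℕ ((2 * W) ^ c′)
            ≡⟨ fromℕ-* (potential T) ((2 * W) ^ c′) ⟨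
          fromℕ (potential T * (2 * W) ^ c′) ∎

      T-upper : potential T ≤ n ^ n * M ^ e
      T-upper = subst (λ m → potential T ≤ n ^ m * M ^ e) (size-bst T bst) (potential-upper n T (≤-reflexive (size-bst T bst)))

      W-upper : W ≤ n * M
      W-upper = subst (λ m → W ≤ m * M) (length-applyUpTo suc n) (weightSum≤ (range n))

      extra-factors : potential T′ ≤ 2 ^ p * potential T′ * weight s ^ c′
      extra-factors = subst (_≤ 2 ^ p * potential T′ * weight s ^ c′)
        (trans (*-identityʳ (1 * potential T′)) (+-identityʳ (potential T′)))
        (*-mono-≤ (*-monoˡ-≤ (potential T′) (m^n>0 2 p))
                  (subst (_≤ weight s ^ c′) (^-zeroˡ c′) (^-monoˡ-≤ c′ (1≤weight s))))

      contradiction : c′ < D → M ^ suc (e + c′) < M ^ suc (e + c′)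
      contradiction c′<D = begin-strict
        M ^ suc (e + c′)                         ≤⟨ ^-monoʳ-≤ M (subst (_≤ exposed T′) (+-suc e c′) (≤-trans (+-monoʳ-≤ e c′<D) gain)) ⟩
        M ^ exposed T′                           ≤⟨ potential-lower T′ ⟩
        potential T′                             ≤⟨ extra-factors ⟩
        2 ^ p * potential T′ * weight s ^ c′     ≤⟨ access ⟩
        potential T * (2 * W) ^ c′               ≤⟨ *-mono-≤ T-upper (^-monoˡ-≤ c′ (*-monoʳ-≤ 2 W-upper)) ⟩
        n ^ n * M ^ e * (2 * (n * M)) ^ c′       ≡⟨ cong (λ x → n ^ n * M ^ e * x) (trans (cong (_^ c′) (sym (*-assoc 2 n M))) (*-^-distrib (2 * n) M c′)) ⟩
        n ^ n * M ^ e * ((2 * n) ^ c′ * M ^ c′)  ≡⟨ solve 4 (λ a b x y → a :* x :* (b :* y) := a :* b :* (x :* y)) refl (n ^ n) ((2 * n) ^ c′) (M ^ e) (M ^ c′) ⟩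
        K * (M ^ e * M ^ c′)                     ≡⟨ cong (K *_) (^-distribˡ-+-* M e c′) ⟨
        K * M ^ (e + c′)                         <⟨ m<n+m (K * M ^ (e + c′)) (m^n>0 M (e + c′)) ⟩
        M ^ suc (e + c′) ∎
        where open ≤-Reasoning

  lightPath-bounded : ∀ {n T s A} → IsBST n T → 1 ≤ s → s ≤ n → Produces n T s A →
    ∀ {L t} → Subtree L T → t ∉ inorder L → t ∈ inorder A → count (inL L) (path t A) ≤ c′
  lightPath-bounded {n} {T} {s} {A} bst 1≤s s≤n prod {L} {t} L⊑T t∉L t∈A
    with after-tree (valid bst 1≤s s≤n prod)
  ... | _ , _ , _ , ordered-A , A↭P =
    exposure-gain-bounded (inL L) n T s A bst 1≤s s≤n prod lights (begin
      exposed T + lights               ≤⟨ +-monoˡ-≤ lights (exposed-subtree T (bst⇒ordered bst) L⊑T) ⟩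
      heavyCount T + lights            ≡⟨ cong (_+ lights) (reattach-count heavy T s A A↭P) ⟨
      heavyCount T′ + lights           ≤⟨ exposure-on-path (outside t∉L) A (hang s T) ordered-A t∈A ⟩
      exposed T′ ∎)
    where
    open ≤-Reasoning
    open LightSubtree L
    T′ = reattach T s A
    lights = count (inL L) (path t A)

  rightDepth-bounded : ∀ {n T s A} → IsBST n T → 1 ≤ s → s ≤ n → Produces n T s A →
    ∀ {t} → t ∈ inorder A → s < t → rightDepth t A ≤ c′
  rightDepth-bounded {T = T} {s} bst 1≤s s≤n prod {t} t∈A s<t
    with after-tree (valid bst 1≤s s≤n prod)
  ... | l , r , refl , (_ , _ , _ , s<r) , A↭P
    with split-right T (bst⇒ordered bst) s<t (∈-resp-↭ A↭P t∈A)
  ... | L , L⊑T , t∉L , path-in-L =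
    ≤-trans (rightDepth≤light (inL L) t A below-t-light) (lightPath-bounded bst 1≤s s≤n prod L⊑T t∉L t∈A)
    where
    A = node l s r
    below-t-light : ∀ {k} → k ∈ path t A → k < t → inL L k ≡ true
    below-t-light k∈P k<t = LightSubtree.inside L
      (path-in-L (∈-resp-↭ A↭P (path-⊆ t A k∈P)) (path-above-root l r s<r s<t k∈P) k<t)

  leftDepth-bounded : ∀ {n T s A} → IsBST n T → 1 ≤ s → s ≤ n → Produces n T s A →
    ∀ {t} → t ∈ inorder A → t < s → leftDepth t A ≤ c′
  leftDepth-bounded {T = T} {s} bst 1≤s s≤n prod {t} t∈A t<s
    with after-tree (valid bst 1≤s s≤n prod)
  ... | l , r , refl , (_ , _ , l<s , _) , A↭P
    with split-left T (bst⇒ordered bst) t<s (∈-resp-↭ A↭P t∈A)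
  ... | L , L⊑T , t∉L , path-in-L =
    ≤-trans (leftDepth≤light (inL L) t A above-t-light) (lightPath-bounded bst 1≤s s≤n prod L⊑T t∉L t∈A)
    where
    A = node l s r
    above-t-light : ∀ {k} → k ∈ path t A → t < k → inL L k ≡ true
    above-t-light k∈P t<k = LightSubtree.inside L
      (path-in-L (∈-resp-↭ A↭P (path-⊆ t A k∈P)) t<k (path-below-root l r l<s t<s k∈P))

theorem2 : (𝒜 : MinSelfAdjusting) → SatisfiesAccessLemmaSOL 𝒜 →
    Σ ℕ λ C →
      ∀ (n : ℕ) (T : Tree) (s : ℕ) (A : Tree) →
      IsBST n T → 1 ≤ s → s ≤ n →
      MinSelfAdjusting.Produces 𝒜 n T s A →
      ∀ (t : ℕ) → t ∈ inorder A →
        (s < t → rightDepth t A ≤ C) × (t < s → leftDepth t A ≤ C)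
theorem2 𝒜 sol = c′ , λ n T s A bst 1≤s s≤n prod t t∈A →
    rightDepth-bounded bst 1≤s s≤n prod t∈A , leftDepth-bounded bst 1≤s s≤n prod t∈A
  where open AccessLemma 𝒜 sol
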